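{- Let $\mathscr{T}$ be a finite trivial kei with underlying set $T$, let $(\mathscr{L},G,\alpha)$ be a concise augmented kei, and let $\eta\colon\mathscr{L}\to\mathscr{T}$ be a kei morphism. For $t\in T$ let $\mathscr{L}_t=\eta^{ -1}(t)$ and let $H_t\le G$ be the subgroup generated by $\{\alpha_x:x\in\mathscr{L}\setminus\mathscr{L}_t\}$. Then: (1) the set $\bigsqcup_{t\in T}H_t\backslash\mathscr{L}_t$ is well defined (each $\mathscr{L}_t$ is $H_t$-invariant), carries a kei structure inherited from $\mathscr{L}$, namely the disjoint union of the keis $H_t\backslash\mathscr{L}_t$, and the natural map from $\mathscr{L}$ onto it is a quotient in the category of keis; (2) for every family of keis $(\k_t)_{t\in T}$, letting $\k_\mathscr{T}=\bigsqcup_{t\in T}\k_t$ (a kei over $\mathscr{T}$ via $\k_t\mapsto t$), there is a natural bijection $$\textnormal{Hom}_{\mathscr{K}\textnormal{ei}_{/\mathscr{T}}}(\mathscr{L},\k_\mathscr{T})\simeq\prod_{t\in T}\textnormal{Hom}_{\mathscr{K}\textnormal{ei}}(H_t\backslash\mathscr{L}_t,\k_t).$$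
   Context: A kei is a set with a binary operation $\triangleright$ such that $x\triangleright x=x$, $x\triangleright(x\triangleright y)=y$, $x\triangleright(y\triangleright z)=(x\triangleright y)\triangleright(x\triangleright z)$; morphisms preserve $\triangleright$; $\mathscr{K}\textnormal{ei}$ is the category of keis and $\mathscr{K}\textnormal{ei}_{/\mathscr{T}}$ the category of keis over $\mathscr{T}$ (morphisms commuting with the structure maps to $\mathscr{T}$). A kei is trivial if $x\triangleright y=y$ for all $x,y$. The disjoint union of keis has the given operations within each part and $x\triangleright y=y$ for $x,y$ in different parts. An augmented kei $(\mathscr{L},G,\alpha)$ is a set with a left action of a group $G$ and a map $\alpha\colon\mathscr{L}\to G$, $x\mapsto\alpha_x$, with $\alpha_x(x)=x$, $\alpha_x^2=1$, $\alpha_{g(x)}=g\alpha_xg^{ -1}$; $\mathscr{L}$ is a kei via $x\triangleright y=\alpha_x(y)$. It is concise if $\{\alpha_x\}$ generates $G$. Each $H_t\backslash\mathscr{L}_t$ carries the operation $\overline x\triangleright\overline y=\overline{x\triangleright y}$. -}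

module Defs where

open import Level using (0ℓ)
open import Data.Nat using (ℕ)
open import Data.Fin using (Fin)
import Data.Fin as Fin
open import Data.Product using (Σ; _×_; _,_; proj₁; proj₂)
open import Data.Unit using (⊤)
open import Relation.Nullary using (¬_; yes; no)
open import Relation.Binary using (Rel; IsEquivalence; DecidableEquality)
open import Relation.Binary.PropositionalEquality
  using (_≡_; refl; sym; trans; cong)
open import Function.Bundles using (_↔_; Inverse)
open import Algebra.Bundles using (Group)

-- A kei structure on a carrier with a (setoid) equality _≈_.
-- For ordinary keis (sets) _≈_ is _≡_.
record IsSetoidKei {A : Set} (_≈_ : Rel A 0ℓ) (_▷_ : A → A → A) : Set where
  field
    isEquivalence : IsEquivalence _≈_
    ▷-cong  : ∀ {x x′ y y′} → x ≈ x′ → y ≈ y′ → (x ▷ y) ≈ (x′ ▷ y′)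
    idem    : ∀ x → (x ▷ x) ≈ x
    invol   : ∀ x y → (x ▷ (x ▷ y)) ≈ y
    distrib : ∀ x y z → (x ▷ (y ▷ z)) ≈ ((x ▷ y) ▷ (x ▷ z))

record Kei : Set₁ where
  field
    Carrier : Set
    _▷_     : Carrier → Carrier → Carrier
    isKei   : IsSetoidKei _≡_ _▷_

open Kei using () renaming (Carrier to ⟦_⟧)

IsTrivial : Kei → Set
IsTrivial K = ∀ x y → Kei._▷_ K x y ≡ y

IsFinite : Kei → Set
IsFinite K = Σ ℕ λ n → Fin n ↔ ⟦ K ⟧

finite-decEq : (K : Kei) → IsFinite K → DecidableEquality ⟦ K ⟧
finite-decEq K (n , e) x y with Inverse.from e x Fin.≟ Inverse.from e y
... | yes p = yes (trans (sym (Inverse.strictlyInverseˡ e x))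
                   (trans (cong (Inverse.to e) p) (Inverse.strictlyInverseˡ e y)))
... | no ¬p = no λ q → ¬p (cong (Inverse.from e) q)

IsKeiHom : {A B : Set} → (A → A → A) → (B → B → B) → (A → B) → Set
IsKeiHom _▷₁_ _▷₂_ f = ∀ x y → f (x ▷₁ y) ≡ (f x ▷₂ f y)

KeiHom : Kei → Kei → Set
KeiHom K K′ = Σ (⟦ K ⟧ → ⟦ K′ ⟧) λ f → IsKeiHom (Kei._▷_ K) (Kei._▷_ K′) f

⊔op : {I : Set} → DecidableEquality I → (A : I → Set) →
      ((i : I) → A i → A i → A i) → Σ I A → Σ I A → Σ I A
⊔op _≟_ A op (s , a) (t , b) with s ≟ t
... | yes refl = (t , op t a b)
... | no _     = (t , b)

record AugKei : Set₁ where
  field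
    Carrier : Set
    G       : Group 0ℓ 0ℓ
  open Group G using (_≈_; _∙_; ε; _⁻¹) renaming (Carrier to ∣G∣)
  field
    act      : ∣G∣ → Carrier → Carrier
    act-ε    : ∀ x → act ε x ≡ x
    act-∙    : ∀ g h x → act (g ∙ h) x ≡ act g (act h x)
    act-cong : ∀ {g h} → g ≈ h → ∀ x → act g x ≡ act h x
    α        : Carrier → ∣G∣
    α-fix    : ∀ x → act (α x) x ≡ x
    α-sq     : ∀ x → (α x ∙ α x) ≈ ε
    α-conj   : ∀ g x → α (act g x) ≈ ((g ∙ α x) ∙ (g ⁻¹))

  _▷_ : Carrier → Carrier → Carrier
  x ▷ y = act (α x) y

  -- subgroup of G generated by {α_x : P x}  (least subgroup containing them)
  data Gen (P : Carrier → Set) : ∣G∣ → Set where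
    gen  : ∀ x → P x → Gen P (α x)
    g-ε  : Gen P ε
    g-∙  : ∀ {g h} → Gen P g → Gen P h → Gen P (g ∙ h)
    g-⁻¹ : ∀ {g} → Gen P g → Gen P (g ⁻¹)
    g-≈  : ∀ {g h} → g ≈ h → Gen P g → Gen P h

IsConcise : AugKei → Set
IsConcise A = ∀ g → AugKei.Gen A (λ _ → ⊤) g

module Setup (T : Kei) (fin : IsFinite T) (triv : IsTrivial T)
             (A : AugKei)
             (η : AugKei.Carrier A → ⟦ T ⟧)
             (ηhom : IsKeiHom (AugKei._▷_ A) (Kei._▷_ T) η) where

  open AugKei A renaming (Carrier to L)
  open Group G using () renaming (Carrier to ∣G∣)

  _≟T_ : DecidableEquality (⟦ T ⟧)
  _≟T_ = finite-decEq T fin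

  H : ⟦ T ⟧ → ∣G∣ → Set
  H t = Gen (λ x → ¬ (η x ≡ t))

  Lt : ⟦ T ⟧ → Set
  Lt t = Σ L λ x → η x ≡ t

  -- the orbit relation of H_t on L_t (points of H_t \ L_t)
  Orb : (t : ⟦ T ⟧) → Rel (Lt t) 0ℓ
  Orb t (x , _) (y , _) = Σ ∣G∣ λ g → H t g × act g x ≡ y

  -- operation on L_t inherited from L (L_t is a subkei since T is trivial)
  ▷t : (t : ⟦ T ⟧) → Lt t → Lt t → Lt t
  ▷t t (x , px) (y , py) =
    (x ▷ y , trans (ηhom x y) (trans (triv (η x) (η y)) py))

  -- the disjoint union ⊔_t H_t \ L_t, represented on Σ t, L_t
  Q : Set
  Q = Σ (⟦ T ⟧) Lt

  data _≈Q_ : Rel Q 0ℓ where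
    inj : ∀ {t a b} → Orb t a b → (t , a) ≈Q (t , b)

  _▷Q_ : Q → Q → Q
  _▷Q_ = ⊔op _≟T_ Lt ▷t

  π : L → Q
  π x = (η x , (x , refl))

  record Part1 : Set₁ where
    field
      invariant    : ∀ t g → H t g → ∀ x → η x ≡ t → η (act g x) ≡ t
      component-kei : ∀ t → IsSetoidKei (Orb t) (▷t t)
      union-kei    : IsSetoidKei _≈Q_ _▷Q_
      π-hom        : ∀ x y → π (x ▷ y) ≈Q (π x ▷Q π y)
      π-surjective : ∀ q → Σ L λ x → π x ≈Q q
      -- π is a quotient in the category of keis: every kei morphism out
      -- of L constant on the fibres of π factors uniquely through π
      π-universal  :
        (C : Kei) (f : L → ⟦ C ⟧) → IsKeiHom _▷_ (Kei._▷_ C) f →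
        (∀ x y → π x ≈Q π y → f x ≡ f y) →
        Σ (Q → ⟦ C ⟧) λ f̄ →
          (∀ {q q′} → q ≈Q q′ → f̄ q ≡ f̄ q′) ×
          IsKeiHom _▷Q_ (Kei._▷_ C) f̄ ×
          (∀ x → f̄ (π x) ≡ f x) ×
          ((f̄′ : Q → ⟦ C ⟧) →
             (∀ {q q′} → q ≈Q q′ → f̄′ q ≡ f̄′ q′) →
             IsKeiHom _▷Q_ (Kei._▷_ C) f̄′ →
             (∀ x → f̄′ (π x) ≡ f x) →
             ∀ q → f̄′ q ≡ f̄ q)

  -- (2)
  -- k_T = ⊔_t k_t, a kei over T via proj₁
  kT : (K : ⟦ T ⟧ → Kei) → Set
  kT K = Σ (⟦ T ⟧) (λ t → ⟦ K t ⟧)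

  _▷kT_ : {K : ⟦ T ⟧ → Kei} → kT K → kT K → kT K
  _▷kT_ {K} = ⊔op _≟T_ (λ t → ⟦ K t ⟧) (λ t → Kei._▷_ (K t))

  HomOver : (K : ⟦ T ⟧ → Kei) → Set
  HomOver K = Σ (L → kT K) λ f →
    IsKeiHom _▷_ (_▷kT_ {K}) f × (∀ x → proj₁ (f x) ≡ η x)

  -- Hom in Kei from H_t \ L_t to a kei B (maps on L_t constant on orbits)
  HomQ : (t : ⟦ T ⟧) → Kei → Set
  HomQ t B = Σ (Lt t → ⟦ B ⟧) λ g →
    (∀ {a b} → Orb t a b → g a ≡ g b) × IsKeiHom (▷t t) (Kei._▷_ B) g

  compQ : ∀ {t B C} → KeiHom B C → HomQ t B → HomQ t C
  compQ (h , hh) (g , gr , gh) =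
    (λ a → h (g a)) , (λ o → cong h (gr o)) ,
    (λ a b → trans (cong h (gh a b)) (hh (g a) (g b)))

  ⊔map : {K K′ : ⟦ T ⟧ → Kei} → ((t : ⟦ T ⟧) → KeiHom (K t) (K′ t)) →
         kT K → kT K′
  ⊔map h (t , a) = (t , proj₁ (h t) a)

  record Part2 : Set₂ where
    field
      Φ : (K : ⟦ T ⟧ → Kei) → HomOver K → (t : ⟦ T ⟧) → HomQ t (K t)
      Ψ : (K : ⟦ T ⟧ → Kei) → ((t : ⟦ T ⟧) → HomQ t (K t)) → HomOver K
      Ψ∘Φ : ∀ K f x → proj₁ (Ψ K (Φ K f)) x ≡ proj₁ f x
      Φ∘Ψ : ∀ K g t a → proj₁ (Φ K (Ψ K g) t) a ≡ proj₁ (g t) a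
      natural : ∀ K K′ (h : (t : ⟦ T ⟧) → KeiHom (K t) (K′ t)) g x →
        proj₁ (Ψ K′ (λ t → compQ {t} {K t} {K′ t} (h t) (g t))) x ≡ ⊔map {K} {K′} h (proj₁ (Ψ K g) x)

-- Since 𝒯 is trivial, η (w ▷ x) = η x, so every α w, hence all of H t, preserves the fibres
-- L t.  The H t-orbits form a congruence for ▷: a generator step y ↦ w ▷ y on the right
-- becomes x ▷ y ↦ (x ▷ w) ▷ (x ▷ y), again a generator step as η (x ▷ w) = η w, and a step
-- on the left reduces to steps on the right through (w ▷ x) ▷ y = w ▷ (x ▷ (w ▷ y)).
-- A morphism f over 𝒯 satisfies f (w ▷ x) = f x whenever η w ≠ η x, since k_𝒯 is trivial
-- across components; so f is constant on the H t-orbits of L t, and its restrictions to the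
-- fibres are exactly the families of maps out of the H t \ L t, which glue back to f.
module Submission where

open import Level using (0ℓ)
open import Data.Product using (Σ; _×_; _,_; proj₁; proj₂)
open import Data.Empty using (⊥-elim)
open import Relation.Nullary using (¬_; yes; no; Dec)
open import Relation.Binary using (Rel; IsEquivalence; DecidableEquality; _⇔_)
open import Relation.Binary.PropositionalEquality
  using (_≡_; refl; sym; trans; cong; subst; module ≡-Reasoning)
  renaming (isEquivalence to ≡-isEquivalence)
import Relation.Binary.Construct.On as On
open import Algebra.Bundles using (Group)
open import Defs

open Kei using () renaming (Carrier to ⟦_⟧)

module ⊔op-Properties {I : Set} (_≟_ : DecidableEquality I) (B : I → Set)
                     (op : (i : I) → B i → B i → B i) where

  ⊔op-same : ∀ i a b → ⊔op _≟_ B op (i , a) (i , b) ≡ (i , op i a b)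
  ⊔op-same i a b with i ≟ i
  ... | yes refl = refl
  ... | no i≢i   = ⊥-elim (i≢i refl)

  ⊔op-diff : ∀ {i j} a b → ¬ i ≡ j → ⊔op _≟_ B op (i , a) (j , b) ≡ (j , b)
  ⊔op-diff {i} {j} a b i≢j with i ≟ j
  ... | yes i≡j = ⊥-elim (i≢j i≡j)
  ... | no _    = refl

IsSetoidKei-resp-⇔ : {A : Set} {_≈_ _≈′_ : Rel A 0ℓ} {_▷_ : A → A → A} →
                     _≈_ ⇔ _≈′_ → IsSetoidKei _≈_ _▷_ → IsSetoidKei _≈′_ _▷_
IsSetoidKei-resp-⇔ (to , from) kei = record
  { isEquivalence = record
    { refl  = to ≈-refl
    ; sym   = λ p → to (≈-sym (from p))
    ; trans = λ p q → to (≈-trans (from p) (from q))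
    }
  ; ▷-cong  = λ p q → to (▷-cong (from p) (from q))
  ; idem    = λ x → to (idem x)
  ; invol   = λ x y → to (invol x y)
  ; distrib = λ x y z → to (distrib x y z)
  }
  where
  open IsSetoidKei kei
  open IsEquivalence isEquivalence renaming (refl to ≈-refl; sym to ≈-sym; trans to ≈-trans)

module DisjointUnion {I : Set} (_≟_ : DecidableEquality I) (B : I → Set)
    (_≈_ : ∀ i → Rel (B i) 0ℓ) (op : (i : I) → B i → B i → B i)
    (isKei : ∀ i → IsSetoidKei (_≈_ i) (op i)) where

  open ⊔op-Properties _≟_ B op

  module B {i} = IsSetoidKei (isKei i)
  module B≈ {i} = IsEquivalence (B.isEquivalence {i})

  data _≈⊔_ : Rel (Σ I B) 0ℓ where
    inj : ∀ {i a b} → _≈_ i a b → (i , a) ≈⊔ (i , b)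

  _▷⊔_ : Σ I B → Σ I B → Σ I B
  _▷⊔_ = ⊔op _≟_ B op

  ≈⊔-refl : ∀ {q} → q ≈⊔ q
  ≈⊔-refl = inj B≈.refl

  ≈⊔-isEquivalence : IsEquivalence _≈⊔_
  ≈⊔-isEquivalence = record
    { refl  = ≈⊔-refl
    ; sym   = λ { (inj p) → inj (B≈.sym p) }
    ; trans = λ { (inj p) (inj q) → inj (B≈.trans p q) }
    }

  ▷⊔-cong : ∀ {q q′ r r′} → q ≈⊔ q′ → r ≈⊔ r′ → (q ▷⊔ r) ≈⊔ (q′ ▷⊔ r′)
  ▷⊔-cong {s , a} {_ , a′} {t , b} {_ , b′} (inj a≈a′) (inj b≈b′) with s ≟ t
  ... | yes refl = inj (B.▷-cong a≈a′ b≈b′)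
  ... | no _     = inj b≈b′

  ▷⊔-idem : ∀ q → (q ▷⊔ q) ≈⊔ q
  ▷⊔-idem (t , a) rewrite ⊔op-same t a a = inj (B.idem a)

  ▷⊔-invol : ∀ q r → (q ▷⊔ (q ▷⊔ r)) ≈⊔ r
  ▷⊔-invol (s , a) (t , b) with s ≟ t
  ... | yes refl rewrite ⊔op-same t a (op t a b) = inj (B.invol a b)
  ... | no s≢t   rewrite ⊔op-diff a b s≢t = ≈⊔-refl

  ▷⊔-distrib : ∀ q r u → (q ▷⊔ (r ▷⊔ u)) ≈⊔ ((q ▷⊔ r) ▷⊔ (q ▷⊔ u))
  ▷⊔-distrib (r , a) (s , b) (t , c) = by-cases (r ≟ s) (s ≟ t) (r ≟ t)
    where
    by-cases : Dec (r ≡ s) → Dec (s ≡ t) → Dec (r ≡ t) →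
               ((r , a) ▷⊔ ((s , b) ▷⊔ (t , c)))
                 ≈⊔ (((r , a) ▷⊔ (s , b)) ▷⊔ ((r , a) ▷⊔ (t , c)))
    by-cases (yes refl) (yes refl) _
      rewrite ⊔op-same t b c | ⊔op-same t a (op t b c)
            | ⊔op-same t a b | ⊔op-same t a c
            | ⊔op-same t (op t a b) (op t a c) = inj (B.distrib a b c)
    by-cases (yes refl) (no s≢t) _
      rewrite ⊔op-diff b c s≢t | ⊔op-diff a c s≢t
            | ⊔op-same s a b | ⊔op-diff (op s a b) c s≢t = ≈⊔-refl
    by-cases (no r≢s) (yes refl) _
      rewrite ⊔op-same s b c | ⊔op-diff a (op s b c) r≢s
            | ⊔op-diff a b r≢s | ⊔op-diff a c r≢s
            | ⊔op-same s b c = ≈⊔-refl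
    by-cases (no r≢s) (no s≢t) (yes refl)
      rewrite ⊔op-diff b c s≢t | ⊔op-same r a c
            | ⊔op-diff a b r≢s | ⊔op-diff b (op r a c) s≢t = ≈⊔-refl
    by-cases (no r≢s) (no s≢t) (no r≢t)
      rewrite ⊔op-diff b c s≢t | ⊔op-diff a c r≢t
            | ⊔op-diff a b r≢s | ⊔op-diff b c s≢t = ≈⊔-refl

  ⊔-isSetoidKei : IsSetoidKei _≈⊔_ _▷⊔_
  ⊔-isSetoidKei = record
    { isEquivalence = ≈⊔-isEquivalence
    ; ▷-cong        = ▷⊔-cong
    ; idem          = ▷⊔-idem
    ; invol         = ▷⊔-invol
    ; distrib       = ▷⊔-distrib
    }

module AugKeiProperties (A : AugKei) where
  open AugKei A renaming (Carrier to L)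
  open Group G using (_∙_; ε; _⁻¹; inverseˡ; inverseʳ)

  act-inverseˡ : ∀ g x → act (g ⁻¹) (act g x) ≡ x
  act-inverseˡ g x = trans (sym (act-∙ (g ⁻¹) g x)) (trans (act-cong (inverseˡ g) x) (act-ε x))

  act-inverseʳ : ∀ g x → act g (act (g ⁻¹) x) ≡ x
  act-inverseʳ g x = trans (sym (act-∙ g (g ⁻¹) x)) (trans (act-cong (inverseʳ g) x) (act-ε x))

  ▷-invol : ∀ x y → x ▷ (x ▷ y) ≡ y
  ▷-invol x y = trans (sym (act-∙ (α x) (α x) y)) (trans (act-cong (α-sq x) y) (act-ε y))

  ▷-distrib : ∀ x y z → x ▷ (y ▷ z) ≡ (x ▷ y) ▷ (x ▷ z)
  ▷-distrib x y z = sym (begin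
    act (α (x ▷ y)) (x ▷ z)                     ≡⟨ act-cong (α-conj (α x) y) (x ▷ z) ⟩
    act ((α x ∙ α y) ∙ α x ⁻¹) (act (α x) z)    ≡⟨ act-∙ (α x ∙ α y) (α x ⁻¹) (x ▷ z) ⟩
    act (α x ∙ α y) (act (α x ⁻¹) (act (α x) z)) ≡⟨ cong (act (α x ∙ α y)) (act-inverseˡ (α x) z) ⟩
    act (α x ∙ α y) z                           ≡⟨ act-∙ (α x) (α y) z ⟩
    x ▷ (y ▷ z)                                 ∎)
    where open ≡-Reasoning

  Gen⇒related : ∀ {P : L → Set} {ℓ} {_~_ : Rel L ℓ} → IsEquivalence _~_ →
                (∀ {w} → P w → ∀ x → x ~ (w ▷ x)) →
                ∀ {g} → Gen P g → ∀ x → x ~ act g x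
  Gen⇒related {P} {_~_ = _~_} ~-isEquivalence generator-related = related
    where
    open IsEquivalence ~-isEquivalence renaming (refl to ~-refl; sym to ~-sym; trans to ~-trans)

    related : ∀ {g} → Gen P g → ∀ x → x ~ act g x
    related (gen w Pw)          x = generator-related Pw x
    related g-ε                 x = subst (x ~_) (sym (act-ε x)) ~-refl
    related (g-∙ {g} {h} p q)   x =
      subst (x ~_) (sym (act-∙ g h x)) (~-trans (related q x) (related p (act h x)))
    related (g-⁻¹ {g} p)        x =
      subst (_~ act (g ⁻¹) x) (act-inverseʳ g x) (~-sym (related p (act (g ⁻¹) x)))
    related (g-≈ {g} {h} g≈h p) x = subst (x ~_) (act-cong g≈h x) (related p x)

  module HomToTrivial (T : Kei) (triv : IsTrivial T) (η : L → ⟦ T ⟧)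
           (ηhom : IsKeiHom _▷_ (Kei._▷_ T) η) where

    η-▷ : ∀ x y → η (x ▷ y) ≡ η y
    η-▷ x y = trans (ηhom x y) (triv (η x) (η y))

    η-act : ∀ {P g} → Gen P g → ∀ x → η (act g x) ≡ η x
    η-act p x =
      sym (Gen⇒related (On.isEquivalence η ≡-isEquivalence) (λ {w} _ y → sym (η-▷ w y)) p x)

module _ (T : Kei) (fin : IsFinite T) (triv : IsTrivial T) (A : AugKei)
         (η : AugKei.Carrier A → ⟦ T ⟧)
         (ηhom : IsKeiHom (AugKei._▷_ A) (Kei._▷_ T) η) where

  open Setup T fin triv A η ηhom
  open AugKei A renaming (Carrier to L)
  open AugKeiProperties A
  open HomToTrivial T triv η ηhom
  open Group G using (_∙_; ε; _⁻¹) renaming (Carrier to ∣G∣)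

  Orbit : ⟦ T ⟧ → Rel L 0ℓ
  Orbit t x y = Σ ∣G∣ λ g → H t g × act g x ≡ y

  Orbit-isEquivalence : ∀ {t} → IsEquivalence (Orbit t)
  Orbit-isEquivalence = record
    { refl  = λ {x} → ε , g-ε , act-ε x
    ; sym   = λ { {x} (g , h , refl) → g ⁻¹ , g-⁻¹ h , act-inverseˡ g x }
    ; trans = λ { {x} (g , hg , refl) (k , hk , refl) → k ∙ g , g-∙ hk hg , act-∙ k g x }
    }

  module Orbit {t} = IsEquivalence (Orbit-isEquivalence {t})

  Orbit-reflexive : ∀ {t x y} → x ≡ y → Orbit t x y
  Orbit-reflexive refl = Orbit.refl

  Orbit-generator : ∀ {t w} → ¬ η w ≡ t → ∀ x → Orbit t x (w ▷ x)
  Orbit-generator {w = w} w∉Lt x = α w , gen w w∉Lt , refl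

  ▷-congʳ-Orbit : ∀ {t} x {y y′} → Orbit t y y′ → Orbit t (x ▷ y) (x ▷ y′)
  ▷-congʳ-Orbit {t} x {y} (g , g∈H , refl) =
    Gen⇒related (On.isEquivalence (x ▷_) Orbit-isEquivalence) generator g∈H y
    where
    generator : ∀ {w} → ¬ η w ≡ t → ∀ y → Orbit t (x ▷ y) (x ▷ (w ▷ y))
    generator {w} w∉Lt y = subst (Orbit t (x ▷ y)) (sym (▷-distrib x w y))
      (Orbit-generator (λ x▷w∈Lt → w∉Lt (trans (sym (η-▷ x w)) x▷w∈Lt)) (x ▷ y))

  ▷-congˡ-Orbit : ∀ {t x x′} y → Orbit t x x′ → Orbit t (x ▷ y) (x′ ▷ y)
  ▷-congˡ-Orbit {t} {x} y (g , g∈H , refl) =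
    Gen⇒related (On.isEquivalence (_▷ y) Orbit-isEquivalence) generator g∈H x
    where
    generator : ∀ {w} → ¬ η w ≡ t → ∀ x → Orbit t (x ▷ y) ((w ▷ x) ▷ y)
    generator {w} w∉Lt x =
      subst (Orbit t (x ▷ y)) (trans (▷-distrib w x (w ▷ y)) (cong ((w ▷ x) ▷_) (▷-invol w y)))
        (Orbit.trans (▷-congʳ-Orbit x (Orbit-generator w∉Lt y))
                     (Orbit-generator w∉Lt (x ▷ (w ▷ y))))

  ▷-cong-Orbit : ∀ {t x x′ y y′} → Orbit t x x′ → Orbit t y y′ → Orbit t (x ▷ y) (x′ ▷ y′)
  ▷-cong-Orbit {x′ = x′} {y = y} x∼x′ y∼y′ =
    Orbit.trans (▷-congˡ-Orbit y x∼x′) (▷-congʳ-Orbit x′ y∼y′)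

  Orb-isSetoidKei : ∀ t → IsSetoidKei (Orb t) (▷t t)
  Orb-isSetoidKei t = record
    { isEquivalence = On.isEquivalence proj₁ Orbit-isEquivalence
    ; ▷-cong        = ▷-cong-Orbit
    ; idem          = λ a → Orbit-reflexive (α-fix (proj₁ a))
    ; invol         = λ a b → Orbit-reflexive (▷-invol (proj₁ a) (proj₁ b))
    ; distrib       = λ a b c → Orbit-reflexive (▷-distrib (proj₁ a) (proj₁ b) (proj₁ c))
    }

  module ⊔ = DisjointUnion _≟T_ Lt Orb ▷t Orb-isSetoidKei

  ≈⊔⇔≈Q : ⊔._≈⊔_ ⇔ _≈Q_
  ≈⊔⇔≈Q = (λ { (⊔.inj o) → inj o }) , (λ { (inj o) → ⊔.inj o })

  union-isSetoidKei : IsSetoidKei _≈Q_ _▷Q_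
  union-isSetoidKei = IsSetoidKei-resp-⇔ ≈⊔⇔≈Q ⊔.⊔-isSetoidKei

  module QKei = IsSetoidKei union-isSetoidKei
  module ≈Q = IsEquivalence QKei.isEquivalence

  ≈Q-intro : ∀ {s t} {a : Lt s} {b : Lt t} →
             s ≡ t → Orbit t (proj₁ a) (proj₁ b) → (s , a) ≈Q (t , b)
  ≈Q-intro refl o = inj o

  π-▷ : ∀ {s t} x y (p : η x ≡ s) (q : η y ≡ t) → π (x ▷ y) ≈Q ((s , x , p) ▷Q (t , y , q))
  π-▷ {s} {t} x y p q with s ≟T t
  ... | yes refl = ≈Q-intro (trans (η-▷ x y) q) Orbit.refl
  ... | no s≢t   = ≈Q-intro (trans (η-▷ x y) q)
                     (Orbit.sym (Orbit-generator (λ x∈Lt → s≢t (trans (sym p) x∈Lt)) y))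

  underlying : Q → L
  underlying (_ , x , _) = x

  π-underlying : ∀ q → π (underlying q) ≈Q q
  π-underlying (_ , x , p) = ≈Q-intro p Orbit.refl

  module Factorisation (C : Kei) (f : L → ⟦ C ⟧) (f-hom : IsKeiHom _▷_ (Kei._▷_ C) f)
                       (f-resp : ∀ x y → π x ≈Q π y → f x ≡ f y) where
    open Kei C using () renaming (_▷_ to _▷C_)

    f̄ : Q → ⟦ C ⟧
    f̄ q = f (underlying q)

    f̄-resp : ∀ {q q′} → q ≈Q q′ → f̄ q ≡ f̄ q′
    f̄-resp {q} {q′} q≈q′ =
      f-resp _ _ (≈Q.trans (π-underlying q) (≈Q.trans q≈q′ (≈Q.sym (π-underlying q′))))

    f̄-hom : IsKeiHom _▷Q_ _▷C_ f̄
    f̄-hom q r = begin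
      f̄ (q ▷Q r)                   ≡⟨ f̄-resp (QKei.▷-cong (≈Q.sym (π-underlying q))
                                                           (≈Q.sym (π-underlying r))) ⟩
      f̄ (π x ▷Q π y)               ≡⟨ f̄-resp (≈Q.sym (π-▷ x y refl refl)) ⟩
      f (x ▷ y)                    ≡⟨ f-hom x y ⟩
      f̄ q ▷C f̄ r                   ∎
      where
      open ≡-Reasoning
      x = underlying q
      y = underlying r

    f̄-unique : (f̄′ : Q → ⟦ C ⟧) → (∀ {q q′} → q ≈Q q′ → f̄′ q ≡ f̄′ q′) →
               (∀ x → f̄′ (π x) ≡ f x) → ∀ q → f̄′ q ≡ f̄ q
    f̄-unique f̄′ f̄′-resp f̄′∘π q = trans (sym (f̄′-resp (π-underlying q))) (f̄′∘π (underlying q))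

  module Classification (K : ⟦ T ⟧ → Kei) where
    ▷K : (t : ⟦ T ⟧) → ⟦ K t ⟧ → ⟦ K t ⟧ → ⟦ K t ⟧
    ▷K t = Kei._▷_ (K t)

    component : ∀ {t} (u : kT K) → proj₁ u ≡ t → ⟦ K t ⟧
    component (_ , k) refl = k

    component-cong : ∀ {t} {u v : kT K} → u ≡ v →
                     (e : proj₁ u ≡ t) (e′ : proj₁ v ≡ t) → component u e ≡ component v e′
    component-cong refl refl refl = refl

    open ⊔op-Properties _≟T_ (λ t → ⟦ K t ⟧) ▷K

    component-▷ : ∀ {t} (u v : kT K) (e : proj₁ u ≡ t) (e′ : proj₁ v ≡ t)
                  (e″ : proj₁ (_▷kT_ {K} u v) ≡ t) →
                  component (_▷kT_ {K} u v) e″ ≡ ▷K t (component u e) (component v e′)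
    component-▷ (t , a) (_ , b) refl refl e″ = component-cong (⊔op-same t a b) e″ refl

    component-η : ∀ {t} (u : kT K) (e : proj₁ u ≡ t) → (t , component u e) ≡ u
    component-η _ refl = refl

    HomOver-orbit-invariant : ((f , _) : HomOver K) →
                              ∀ {t x y} → Orbit t x y → η x ≡ t → f x ≡ f y
    HomOver-orbit-invariant (f , f-hom , f-η) {t} {x} (g , g∈H , refl) x∈Lt =
      proj₂ (Gen⇒related agree-isEquivalence generator g∈H x) x∈Lt
      where
      -- Without the η-component this relation would not be transitive.
      AgreeOnLt : Rel L 0ℓ
      AgreeOnLt x y = η x ≡ η y × (η x ≡ t → f x ≡ f y)

      agree-isEquivalence : IsEquivalence AgreeOnLt
      agree-isEquivalence = record
        { refl  = refl , λ _ → refl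
        ; sym   = λ (e , agree) → sym e , λ y∈Lt → sym (agree (trans e y∈Lt))
        ; trans = λ (e , agree) (e′ , agree′) →
            trans e e′ , λ x∈Lt → trans (agree x∈Lt) (agree′ (trans (sym e) x∈Lt))
        }

      generator : ∀ {w} → ¬ η w ≡ t → ∀ x → AgreeOnLt x (w ▷ x)
      generator {w} w∉Lt x = sym (η-▷ w x) , λ x∈Lt → sym (trans (f-hom w x)
        (⊔op-diff (proj₂ (f w)) (proj₂ (f x))
          (λ fw≡fx → w∉Lt (trans (sym (f-η w)) (trans fw≡fx (trans (f-η x) x∈Lt))))))

    restrict : HomOver K → (t : ⟦ T ⟧) → HomQ t (K t)
    restrict (f , f-hom , f-η) t = fₜ , fₜ-resp , fₜ-hom
      where
      f-over : (a : Lt t) → proj₁ (f (proj₁ a)) ≡ t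
      f-over (x , x∈Lt) = trans (f-η x) x∈Lt

      fₜ : Lt t → ⟦ K t ⟧
      fₜ a = component (f (proj₁ a)) (f-over a)

      fₜ-resp : ∀ {a b} → Orb t a b → fₜ a ≡ fₜ b
      fₜ-resp {a} {b} a∼b =
        component-cong (HomOver-orbit-invariant (f , f-hom , f-η) a∼b (proj₂ a))
                       (f-over a) (f-over b)

      fₜ-hom : IsKeiHom (▷t t) (▷K t) fₜ
      fₜ-hom a@(x , _) b@(y , _) =
        trans (component-cong (f-hom x y) (f-over (▷t t a b)) fx▷fy-over)
              (component-▷ (f x) (f y) (f-over a) (f-over b) fx▷fy-over)
        where
        fx▷fy-over : proj₁ (_▷kT_ {K} (f x) (f y)) ≡ t
        fx▷fy-over = trans (cong proj₁ (sym (f-hom x y))) (f-over (▷t t a b))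

    module Glue (gs : (t : ⟦ T ⟧) → HomQ t (K t)) where
      g : ∀ t → Lt t → ⟦ K t ⟧
      g t = proj₁ (gs t)

      g-resp : ∀ t {a b} → Orb t a b → g t a ≡ g t b
      g-resp t = proj₁ (proj₂ (gs t))

      glue : L → kT K
      glue x = η x , g (η x) (x , refl)

      glue-at : ∀ {t} x (x∈Lt : η x ≡ t) → glue x ≡ (t , g t (x , x∈Lt))
      glue-at x refl = refl

      glue-▷ : ∀ {s t} x y (x∈Ls : η x ≡ s) (y∈Lt : η y ≡ t) →
               (t , g t (x ▷ y , trans (η-▷ x y) y∈Lt))
                 ≡ _▷kT_ {K} (s , g s (x , x∈Ls)) (t , g t (y , y∈Lt))
      glue-▷ {s} {t} x y x∈Ls y∈Lt with s ≟T t
      ... | yes refl = cong (t ,_)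
        (trans (g-resp t Orbit.refl) (proj₂ (proj₂ (gs t)) (x , x∈Ls) (y , y∈Lt)))
      ... | no s≢t   = cong (t ,_)
        (g-resp t (Orbit.sym (Orbit-generator (λ x∈Lt → s≢t (trans (sym x∈Ls) x∈Lt)) y)))

      glue-hom : IsKeiHom _▷_ (_▷kT_ {K}) glue
      glue-hom x y = trans (glue-at (x ▷ y) (trans (η-▷ x y) refl)) (glue-▷ x y refl refl)

      glued : HomOver K
      glued = glue , glue-hom , λ _ → refl

      restrict-glued : ∀ t a → proj₁ (restrict glued t) a ≡ g t a
      restrict-glued _ (_ , refl) = refl

    glue-restrict : ∀ f x → proj₁ (Glue.glued (restrict f)) x ≡ proj₁ f x
    glue-restrict (f , _ , f-η) x = component-η (f x) (trans (f-η x) refl)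

  part1 : Part1
  part1 = record
    { invariant     = λ t g g∈H x x∈Lt → trans (η-act g∈H x) x∈Lt
    ; component-kei = Orb-isSetoidKei
    ; union-kei     = union-isSetoidKei
    ; π-hom         = λ x y → π-▷ x y refl refl
    ; π-surjective  = λ q → underlying q , π-underlying q
    ; π-universal   = λ C f f-hom f-resp → let open Factorisation C f f-hom f-resp in
        f̄ , f̄-resp , f̄-hom , (λ _ → refl) , λ f̄′ f̄′-resp _ → f̄-unique f̄′ f̄′-resp
    }

  part2 : Part2
  part2 = record
    { Φ       = Classification.restrict
    ; Ψ       = Classification.Glue.glued
    ; Ψ∘Φ     = Classification.glue-restrict
    ; Φ∘Ψ     = Classification.Glue.restrict-glued
    ; natural = λ _ _ _ _ _ → refl
    }

proposition2p31 : (T : Kei) (fin : IsFinite T) (triv : IsTrivial T)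
                  (A : AugKei) → IsConcise A →
                  (η : AugKei.Carrier A → Kei.Carrier T)
                  (ηhom : IsKeiHom (AugKei._▷_ A) (Kei._▷_ T) η) →
                  Setup.Part1 T fin triv A η ηhom × Setup.Part2 T fin triv A η ηhom
proposition2p31 T fin triv A _ η ηhom = part1 T fin triv A η ηhom , part2 T fin triv A η ηhom
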